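{- Let $m\ge2$, $g\ge0$ and $n=m+g(m-1)$. For every $m$-ary tree $t$ with $n$ leaves, $\sigma_m(t)$ is an $(m-1)$-Dyck path of length $n-1$.
   Context: An $m$-ary tree is a rooted tree in which each node has either $0$ or $m$ linearly ordered children. For $m$-ary trees $t_1,\dots,t_m$, $t_1\wedge\dots\wedge t_m$ is the tree whose root has $t_i$ as the subtree at its $i$-th child; every tree with more than one node is uniquely of this form. Write $N$ for the unit step $(1,1)$ and $S$ for $(1,-1)$, and identify lattice paths with words in $N,S$. The map $\sigma_m$ is defined recursively: $\sigma_m(\varepsilon)$ is the empty word for the one-node tree $\varepsilon$, and $\sigma_m(t_1\wedge\dots\wedge t_m)=N^{m-1}\sigma_m(t_1)S\sigma_m(t_2)S\dots S\sigma_m(t_m)$. An $(m-1)$-Dyck path is a lattice path starting at $(0,0)$ built from up-steps $(m-1,m-1)$ (i.e. $N^{m-1}$) and down-steps $(1,-1)$, never going below the $x$-axis and ending on the $x$-axis; its length is its number of down-steps. -}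

module Defs where

open import Data.Nat using (ℕ; zero; suc; _+_; _∸_)
open import Data.List using (List; []; _∷_; _++_; replicate; length; filter)
open import Data.Vec using (Vec; []; _∷_)
open import Relation.Binary.PropositionalEquality using (_≡_)

data Tree (m : ℕ) : Set where
  leaf : Tree m
  node : Vec (Tree m) m → Tree m   -- node (t₁ ∷ … ∷ tₘ ∷ []) = t₁ ∧ … ∧ tₘ

leaves : ∀ {m} → Tree m → ℕ
leavesV : ∀ {m k} → Vec (Tree m) k → ℕ
leaves leaf = 1
leaves (node ts) = leavesV ts
leavesV [] = 0
leavesV (t ∷ ts) = leaves t + leavesV ts

-- unit steps N = (1,1), S = (1,-1); lattice paths are words in N, S
data Step : Set where
  N S : Step

Word : Set
Word = List Step

σ : ∀ {m} → Tree m → Word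
σchildren : ∀ {m k} → Vec (Tree m) k → Word
σ leaf = []
σ {m} (node ts) = replicate (m ∸ 1) N ++ σchildren ts
σchildren [] = []
σchildren (t ∷ []) = σ t
σchildren (t ∷ t′ ∷ ts) = σ t ++ (S ∷ σchildren (t′ ∷ ts))

-- big steps of an (m-1)-Dyck path: up-step (m-1,m-1) = N^{m-1}, down-step (1,-1) = S
data BigStep : Set where
  up down : BigStep

flatten : ℕ → List BigStep → Word
flatten m [] = []
flatten m (up ∷ bs) = replicate (m ∸ 1) N ++ flatten m bs
flatten m (down ∷ bs) = S ∷ flatten m bs

-- ValidFrom m h bs: starting at height h, the big-step path bs never goes
-- below the x-axis and ends on the x-axis.
data ValidFrom (m : ℕ) : ℕ → List BigStep → Set where
  done  : ValidFrom m 0 []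
  vup   : ∀ {h bs} → ValidFrom m (h + (m ∸ 1)) bs → ValidFrom m h (up ∷ bs)
  vdown : ∀ {h bs} → ValidFrom m h bs → ValidFrom m (suc h) (down ∷ bs)

downs : List BigStep → ℕ
downs [] = 0
downs (up ∷ bs) = downs bs
downs (down ∷ bs) = suc (downs bs)

-- w is an (m-1)-Dyck path of length ℓ (ℓ = number of down-steps),
-- starting at (0,0)
record IsDyck (m : ℕ) (ℓ : ℕ) (w : Word) : Set where
  constructor mkDyck
  field
    steps    : List BigStep
    spells   : flatten m steps ≡ w
    valid    : ValidFrom m 0 steps
    lengthIs : downs steps ≡ ℓ

module Submission where

-- Reading σ_m(t) in blocks N^{m-1} and S, every internal node contributes one
-- up-step followed by its m children separated by m - 1 down-steps. Hence the
-- big-step path of a subtree returns to its starting height and never dips below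
-- it, and it has exactly one down-step fewer than the subtree has leaves.

open import Defs
open import Data.Nat using (ℕ; suc; _+_; _*_; _∸_; _≤_; s≤s)
open import Data.Nat.Properties using (+-suc; +-identityʳ)
open import Data.List using (List; []; _∷_; _++_; replicate)
open import Data.List.Properties using (++-assoc; ++-identityʳ)
open import Data.Vec using (Vec; []; _∷_)
open import Relation.Binary.PropositionalEquality
open ≡-Reasoning

flatten-++ : ∀ m bs cs → flatten m (bs ++ cs) ≡ flatten m bs ++ flatten m cs
flatten-++ m []          cs = refl
flatten-++ m (up ∷ bs)   cs = begin
  replicate (m ∸ 1) N ++ flatten m (bs ++ cs)
    ≡⟨ cong (replicate (m ∸ 1) N ++_) (flatten-++ m bs cs) ⟩
  replicate (m ∸ 1) N ++ (flatten m bs ++ flatten m cs)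
    ≡⟨ ++-assoc (replicate (m ∸ 1) N) (flatten m bs) (flatten m cs) ⟨
  (replicate (m ∸ 1) N ++ flatten m bs) ++ flatten m cs ∎
flatten-++ m (down ∷ bs) cs = cong (S ∷_) (flatten-++ m bs cs)

downs-++ : ∀ bs cs → downs (bs ++ cs) ≡ downs bs + downs cs
downs-++ []          cs = refl
downs-++ (up ∷ bs)   cs = downs-++ bs cs
downs-++ (down ∷ bs) cs = cong suc (downs-++ bs cs)

bigSteps : ∀ {k} → Tree (suc k) → List BigStep
bigStepsᶜ : ∀ {k j} → Vec (Tree (suc k)) (suc j) → List BigStep
bigSteps leaf      = []
bigSteps (node ts) = up ∷ bigStepsᶜ ts
bigStepsᶜ (t ∷ [])      = bigSteps t
bigStepsᶜ (t ∷ t′ ∷ ts) = bigSteps t ++ (down ∷ bigStepsᶜ (t′ ∷ ts))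

flatten-bigSteps : ∀ {k} (t : Tree (suc k)) → flatten (suc k) (bigSteps t) ≡ σ t
flatten-bigStepsᶜ : ∀ {k j} (ts : Vec (Tree (suc k)) (suc j)) →
                    flatten (suc k) (bigStepsᶜ ts) ≡ σchildren ts
flatten-bigSteps leaf      = refl
flatten-bigSteps (node ts) = cong (replicate _ N ++_) (flatten-bigStepsᶜ ts)
flatten-bigStepsᶜ (t ∷ [])          = flatten-bigSteps t
flatten-bigStepsᶜ {k} (t ∷ t′ ∷ ts) = begin
  flatten (suc k) (bigSteps t ++ down ∷ bigStepsᶜ (t′ ∷ ts))
    ≡⟨ flatten-++ (suc k) (bigSteps t) (down ∷ bigStepsᶜ (t′ ∷ ts)) ⟩
  flatten (suc k) (bigSteps t) ++ S ∷ flatten (suc k) (bigStepsᶜ (t′ ∷ ts))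
    ≡⟨ cong₂ (λ u v → u ++ S ∷ v) (flatten-bigSteps t) (flatten-bigStepsᶜ (t′ ∷ ts)) ⟩
  σ t ++ S ∷ σchildren (t′ ∷ ts) ∎

suc-downs-bigSteps : ∀ {k} (t : Tree (suc k)) → suc (downs (bigSteps t)) ≡ leaves t
suc-downs-bigStepsᶜ : ∀ {k j} (ts : Vec (Tree (suc k)) (suc j)) →
                      suc (downs (bigStepsᶜ ts)) ≡ leavesV ts
suc-downs-bigSteps leaf      = refl
suc-downs-bigSteps (node ts) = suc-downs-bigStepsᶜ ts
suc-downs-bigStepsᶜ (t ∷ [])      = trans (suc-downs-bigSteps t) (sym (+-identityʳ (leaves t)))
suc-downs-bigStepsᶜ (t ∷ t′ ∷ ts) = begin
  suc (downs (bigSteps t ++ down ∷ bigStepsᶜ (t′ ∷ ts)))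
    ≡⟨ cong suc (downs-++ (bigSteps t) (down ∷ bigStepsᶜ (t′ ∷ ts))) ⟩
  suc (downs (bigSteps t) + suc (downs (bigStepsᶜ (t′ ∷ ts))))
    ≡⟨ cong₂ _+_ (suc-downs-bigSteps t) (suc-downs-bigStepsᶜ (t′ ∷ ts)) ⟩
  leaves t + leavesV (t′ ∷ ts) ∎

-- The path of j + 1 children ends j levels below its start, one S between
-- consecutive children; the up-step of their parent is exactly m - 1 = j.
bigSteps-valid : ∀ {k h rest} (t : Tree (suc k)) →
                 ValidFrom (suc k) h rest → ValidFrom (suc k) h (bigSteps t ++ rest)
bigStepsᶜ-valid : ∀ {k j h rest} (ts : Vec (Tree (suc k)) (suc j)) →
                  ValidFrom (suc k) h rest → ValidFrom (suc k) (h + j) (bigStepsᶜ ts ++ rest)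
bigSteps-valid leaf      v = v
bigSteps-valid (node ts) v = vup (bigStepsᶜ-valid ts v)
bigStepsᶜ-valid {h = h} (t ∷ []) v =
  subst (λ x → ValidFrom _ x _) (sym (+-identityʳ h)) (bigSteps-valid t v)
bigStepsᶜ-valid {k} {suc j} {h} {rest} (t ∷ t′ ∷ ts) v =
  subst (ValidFrom (suc k) (h + suc j)) (sym (++-assoc (bigSteps t) _ rest))
    (bigSteps-valid t
      (subst (λ x → ValidFrom (suc k) x (down ∷ bigStepsᶜ (t′ ∷ ts) ++ rest)) (sym (+-suc h j))
        (vdown (bigStepsᶜ-valid (t′ ∷ ts) v))))

σ-isDyck : ∀ {k} (t : Tree (suc k)) → IsDyck (suc k) (leaves t ∸ 1) (σ t)
σ-isDyck t = mkDyck (bigSteps t) (flatten-bigSteps t) valid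
                    (cong (_∸ 1) (suc-downs-bigSteps t))
  where
  valid : ValidFrom _ 0 (bigSteps t)
  valid = subst (ValidFrom _ 0) (++-identityʳ (bigSteps t)) (bigSteps-valid t done)

lemma3p5 : (m g : ℕ) → 2 ≤ m → (t : Tree m) → leaves t ≡ m + g * (m ∸ 1) → IsDyck m (m + g * (m ∸ 1) ∸ 1) (σ t)
lemma3p5 (suc k) g (s≤s _) t leaves≡ =
  subst (λ ℓ → IsDyck (suc k) (ℓ ∸ 1) (σ t)) leaves≡ (σ-isDyck t)
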